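{- Let $D$ be a strong digraph with $\mathsf{d}_s^-(D)=\delta^+(D)+1$ and let $N_0$ be the set of vertices of $D$ of minimum out-degree. Then (a) $N_0$ is an in-dominating set and $D\langle N_0\rangle$ is a complete digraph; (b) $\gamma_{cl}(UG(D))\le |N_0|$.
   Context: Digraphs are finite, loopless, without parallel arcs. A digraph is strong if for every ordered pair $u,v$ there is a directed $uv$-walk. $S\subseteq V(D)$ is in-dominating if every vertex not in $S$ has an out-neighbor in $S$; strong in-dominating if moreover $D\langle S\rangle$ is strong. $\mathsf{d}_s^-(D)$ is the maximum number of classes of a partition of $V(D)$ into strong in-dominating sets; $\delta^+(D)$ is the minimum out-degree. A complete digraph contains both arcs between any two distinct vertices. $UG(D)$ is the underlying simple graph; $\gamma_{cl}(G)$ is the minimum cardinality of a dominating clique of $G$ (a clique $S$ such that every vertex outside $S$ is adjacent to a vertex of $S$). -}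

module Defs where

open import Data.Nat using (ℕ; _≤_; _≡ᵇ_)
open import Data.Bool using (Bool; true; false)
open import Data.Fin using (Fin)
open import Data.Fin.Subset using (Subset; _∈_; _∉_; Nonempty; ∣_∣)
open import Data.List using (length; filterᵇ; allFin)
open import Data.Vec using (tabulate)
open import Data.Product using (Σ; ∃; _×_)
open import Data.Sum using (_⊎_)
open import Relation.Nullary using (¬_)
open import Relation.Binary.PropositionalEquality using (_≡_; _≢_)

record Digraph (n : ℕ) : Set where
  field
    adj      : Fin n → Fin n → Bool
    loopless : ∀ u → adj u u ≡ false
open Digraph public

module _ {n : ℕ} (D : Digraph n) where

  Arc : Fin n → Fin n → Set
  Arc u v = adj D u v ≡ true

  outdeg : Fin n → ℕ
  outdeg u = length (filterᵇ (adj D u) (allFin n))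

  IsMinOutdeg : ℕ → Set
  IsMinOutdeg δ = (∃ λ u → outdeg u ≡ δ) × (∀ u → δ ≤ outdeg u)

  data WalkIn (S : Subset n) : Fin n → Fin n → Set where
    nil  : ∀ {u} → u ∈ S → WalkIn S u u
    cons : ∀ {u w v} → u ∈ S → Arc u w → WalkIn S w v → WalkIn S u v

  InducedStrong : Subset n → Set
  InducedStrong S = ∀ u v → u ∈ S → v ∈ S → WalkIn S u v

  Strong : Set
  Strong = ∀ (u v : Fin n) → WalkIn (tabulate (λ _ → true)) u v

  InDominating : Subset n → Set
  InDominating S = ∀ v → v ∉ S → ∃ λ w → w ∈ S × Arc v w

  StrongInDominating : Subset n → Set
  StrongInDominating S = InDominating S × InducedStrong S

  record StrongInDomPartition (k : ℕ) : Set where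
    field
      class    : Fin k → Subset n
      covers   : ∀ v → ∃ λ i → v ∈ class i
      disjoint : ∀ v i j → v ∈ class i → v ∈ class j → i ≡ j
      nonempty : ∀ i → Nonempty (class i)
      strongID : ∀ i → StrongInDominating (class i)

  IsDsMinus : ℕ → Set
  IsDsMinus k = StrongInDomPartition k × (∀ m → StrongInDomPartition m → m ≤ k)

  N₀ : ℕ → Subset n
  N₀ δ = tabulate (λ u → outdeg u ≡ᵇ δ)

  CompleteOn : Subset n → Set
  CompleteOn S = ∀ u v → u ∈ S → v ∈ S → u ≢ v → Arc u v

  UGAdj : Fin n → Fin n → Set
  UGAdj u v = Arc u v ⊎ Arc v u

  DominatingCliqueUG : Subset n → Set
  DominatingCliqueUG S =
    (∀ u v → u ∈ S → v ∈ S → u ≢ v → UGAdj u v) ×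
    (∀ v → v ∉ S → ∃ λ w → w ∈ S × UGAdj v w)

  GammaClAtMost : ℕ → Set
  GammaClAtMost m = ∃ λ S → DominatingCliqueUG S × ∣ S ∣ ≤ m

-- Fix a partition of V(D) into δ⁺(D) + 1 strong in-dominating classes and a vertex v of out-degree
-- δ⁺(D). Each of the δ⁺(D) other classes contains an out-neighbour of v, and these are distinct, so v
-- has no out-neighbour in its own class; as that class is strong, it is {v}. Being in-dominating,
-- {v} receives an arc from every other vertex. Hence N₀ is complete and in-dominating, and it is itself
-- a dominating clique of UG(D).
module Submission where

open import Defs
open import Data.Nat using (ℕ; _+_)
open import Data.Product using (_×_)
open import Data.Fin.Subset using (∣_∣)

open import Data.Bool using (Bool; true; T?)
open import Data.Bool.Properties using (T-≡)
open import Data.Empty using (⊥-elim)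
open import Data.Fin using (Fin; toℕ)
open import Data.Fin.Properties using (pigeonhole; _≟_)
open import Data.Fin.Subset using (_∈_; _∉_)
open import Data.List using (List; length; filterᵇ; allFin)
open import Data.List.Membership.Propositional using () renaming (_∈_ to _∈ₗ_)
open import Data.List.Membership.Propositional.Properties using (∈-filter⁺; ∈-allFin)
open import Data.List.Membership.Setoid.Properties using (index-injective)
open import Data.List.Relation.Unary.Any using (index)
open import Data.Nat using (_≤_; _<_; _<?_; s≤s; z≤n)
open import Data.Nat.Properties using (≮⇒≥; <⇒≢; <-≤-trans; ≤-refl; m<m+n; ≡ᵇ⇒≡; ≡⇒≡ᵇ)
open import Data.Product using (∃; _,_; proj₁; proj₂)
open import Data.Sum using (inj₁)
open import Data.Vec using (tabulate)
open import Data.Vec.Properties using (lookup∘tabulate; []=⇒lookup; lookup⇒[]=)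
open import Function using (Equivalence; _∘_)
open import Function.Definitions using (Injective)
open import Relation.Nullary using (¬_; yes; no)
open import Relation.Binary.PropositionalEquality using (_≡_; _≢_; refl; sym; trans; cong; subst; setoid)

injective⇒≤-length : ∀ {A : Set} {k} (xs : List A) (f : Fin k → A) →
  (∀ j → f j ∈ₗ xs) → Injective _≡_ _≡_ f → k ≤ length xs
injective⇒≤-length {k = k} xs f f∈xs f-inj with length xs <? k
... | no ≮ = ≮⇒≥ ≮
... | yes xs<k with i , j , i<j , same-index ← pigeonhole xs<k (index ∘ f∈xs) =
  ⊥-elim (<⇒≢ i<j (cong toℕ (f-inj (index-injective (setoid _) (f∈xs i) (f∈xs j) same-index))))

∈-tabulate⁻ : ∀ {n} (g : Fin n → Bool) {x} → x ∈ tabulate g → g x ≡ true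
∈-tabulate⁻ g {x} x∈ = trans (sym (lookup∘tabulate g x)) ([]=⇒lookup x∈)

∈-tabulate⁺ : ∀ {n} (g : Fin n → Bool) {x} → g x ≡ true → x ∈ tabulate g
∈-tabulate⁺ g {x} gx = lookup⇒[]= x (tabulate g) (trans (lookup∘tabulate g x) gx)

module _ {n : ℕ} (D : Digraph n) where

  ∈N₀⇒outdeg≡ : ∀ {δ v} → v ∈ N₀ D δ → outdeg D v ≡ δ
  ∈N₀⇒outdeg≡ v∈ = ≡ᵇ⇒≡ _ _ (Equivalence.from T-≡ (∈-tabulate⁻ _ v∈))

  outdeg≡⇒∈N₀ : ∀ {δ v} → outdeg D v ≡ δ → v ∈ N₀ D δ
  outdeg≡⇒∈N₀ dv = ∈-tabulate⁺ _ (Equivalence.to T-≡ (≡⇒≡ᵇ _ _ dv))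

  injective-outNeighbours⇒≤-outdeg : ∀ {k v} (f : Fin k → Fin n) →
    (∀ j → Arc D v (f j)) → Injective _≡_ _≡_ f → k ≤ outdeg D v
  injective-outNeighbours⇒≤-outdeg {v = v} f arcs =
    injective⇒≤-length _ f (λ j → ∈-filter⁺ (T? ∘ adj D v) (∈-allFin (f j)) (Equivalence.from T-≡ (arcs j)))

  walk-head∈ : ∀ {S u v} → WalkIn D S u v → u ∈ S
  walk-head∈ (nil u∈) = u∈
  walk-head∈ (cons u∈ _ _) = u∈

  strong-without-outNeighbour⇒singleton : ∀ {S v} → InducedStrong D S → v ∈ S →
    (∀ w → w ∈ S → ¬ Arc D v w) → ∀ w → w ∈ S → w ≡ v
  strong-without-outNeighbour⇒singleton {v = v} strong v∈ no-arc w w∈ with strong v w v∈ w∈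
  ... | nil _ = refl
  ... | cons _ v→x x⇝w = ⊥-elim (no-arc _ (walk-head∈ x⇝w) v→x)

  module _ {k : ℕ} (P : StrongInDomPartition D k) where
    open StrongInDomPartition P

    ownClass-outNeighbour⇒≤-outdeg : ∀ {v w i} → v ∈ class i → w ∈ class i → Arc D v w →
      k ≤ outdeg D v
    ownClass-outNeighbour⇒≤-outdeg {v} {w} {i} v∈i w∈i v→w =
      injective-outNeighbours⇒≤-outdeg (proj₁ ∘ outNeighbourIn) (proj₂ ∘ proj₂ ∘ outNeighbourIn)
        (λ {a} {b} same → disjoint _ a b (∈class a) (subst (_∈ class b) (sym same) (∈class b)))
      where
      outNeighbourIn : ∀ j → ∃ λ x → x ∈ class j × Arc D v x
      outNeighbourIn j with i ≟ j
      ... | yes refl = w , w∈i , v→w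
      ... | no i≢j = proj₁ (strongID j) v (i≢j ∘ disjoint v i j v∈i)

      ∈class : ∀ j → proj₁ (outNeighbourIn j) ∈ class j
      ∈class = proj₁ ∘ proj₂ ∘ outNeighbourIn

    outdeg<⇒singleton-class : ∀ {v i} → outdeg D v < k → v ∈ class i → ∀ w → w ∈ class i → w ≡ v
    outdeg<⇒singleton-class {i = i} small v∈i =
      strong-without-outNeighbour⇒singleton (proj₂ (strongID i)) v∈i
        (λ w w∈i v→w → <⇒≢ (<-≤-trans small (ownClass-outNeighbour⇒≤-outdeg v∈i w∈i v→w)) refl)

    outdeg<⇒arcs-from-all : ∀ {v} → outdeg D v < k → ∀ u → u ≢ v → Arc D u v
    outdeg<⇒arcs-from-all {v} small u u≢v with i , v∈i ← covers v
      with x , x∈i , u→x ← proj₁ (strongID i) u (u≢v ∘ outdeg<⇒singleton-class small v∈i u) =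
      subst (Arc D u) (outdeg<⇒singleton-class small v∈i x x∈i) u→x

corollary2 : ∀ {n} (D : Digraph n) (δ : ℕ) → Strong D → IsMinOutdeg D δ →
    IsDsMinus D (δ + 1) →
    (InDominating D (N₀ D δ) × CompleteOn D (N₀ D δ)) × GammaClAtMost D ∣ N₀ D δ ∣
corollary2 D δ _ ((v₀ , outdeg-v₀) , _) (P , _) =
  (in-dominating , complete) , N₀ D δ , (clique , dominating) , ≤-refl
  where
  arcs-into-N₀ : ∀ u v → v ∈ N₀ D δ → u ≢ v → Arc D u v
  arcs-into-N₀ u v v∈N₀ = outdeg<⇒arcs-from-all D P
    (subst (_< δ + 1) (sym (∈N₀⇒outdeg≡ D v∈N₀)) (m<m+n δ (s≤s z≤n))) u

  v₀∈N₀ : v₀ ∈ N₀ D δ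
  v₀∈N₀ = outdeg≡⇒∈N₀ D outdeg-v₀

  in-dominating : InDominating D (N₀ D δ)
  in-dominating v v∉N₀ = v₀ , v₀∈N₀ , arcs-into-N₀ v v₀ v₀∈N₀ (λ { refl → v∉N₀ v₀∈N₀ })

  complete : CompleteOn D (N₀ D δ)
  complete u v _ v∈N₀ = arcs-into-N₀ u v v∈N₀

  clique : ∀ u v → u ∈ N₀ D δ → v ∈ N₀ D δ → u ≢ v → UGAdj D u v
  clique u v u∈N₀ v∈N₀ = inj₁ ∘ complete u v u∈N₀ v∈N₀

  dominating : ∀ v → v ∉ N₀ D δ → ∃ λ w → w ∈ N₀ D δ × UGAdj D v w
  dominating v v∉N₀ with w , w∈N₀ , v→w ← in-dominating v v∉N₀ = w , w∈N₀ , inj₁ v→w
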